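{- Let $(A,X,I)$ be a formal context and $\mathcal{R}$ a family of $I$-compatible relations on $A\times X$. Then (1) $\bigcap\mathcal{R}$ is an $I$-compatible relation; (2) $(\bigcap\mathcal{R})^\downarrow[Y]=\bigcap_{T\in\mathcal{R}}T^\downarrow[Y]$ for every $Y\subseteq X$.
   Context: For $S\subseteq A\times X$, $B\subseteq A$, $Y\subseteq X$: $S^\uparrow[B]=\{x\mid\forall a\in B,\ aSx\}$, $S^\downarrow[Y]=\{a\mid\forall x\in Y,\ aSx\}$, $S^\uparrow[a]=S^\uparrow[\{a\}]$, $S^\downarrow[x]=S^\downarrow[\{x\}]$, $B^\uparrow=I^\uparrow[B]$, $Y^\downarrow=I^\downarrow[Y]$. Galois-stable: $B=B^{\uparrow\downarrow}$, $Y=Y^{\downarrow\uparrow}$. $R$ is $I$-compatible if $R^\downarrow[x]$ and $R^\uparrow[a]$ are Galois-stable for all $x\in X$, $a\in A$. -}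

module Defs where

open import Data.Product using (_×_)
open import Relation.Unary using (Pred; _≐_)
open import Relation.Binary using (REL)
open import Level using (0ℓ)

_↑[_] : {A X : Set} → REL A X 0ℓ → Pred A 0ℓ → Pred X 0ℓ
(S ↑[ B ]) x = ∀ a → B a → S a x

_↓[_] : {A X : Set} → REL A X 0ℓ → Pred X 0ℓ → Pred A 0ℓ
(S ↓[ Y ]) a = ∀ x → Y x → S a x

⟦_⟧ : {B : Set} → B → Pred B 0ℓ
⟦ b ⟧ b' = b' Relation.Binary.PropositionalEquality.≡ b
  where import Relation.Binary.PropositionalEquality

GaloisStableA : {A X : Set} → REL A X 0ℓ → Pred A 0ℓ → Set
GaloisStableA I B = B ≐ (I ↓[ I ↑[ B ] ])

GaloisStableX : {A X : Set} → REL A X 0ℓ → Pred X 0ℓ → Set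
GaloisStableX I Y = Y ≐ (I ↑[ I ↓[ Y ] ])

Compatible : {A X : Set} → REL A X 0ℓ → REL A X 0ℓ → Set
Compatible {A} {X} I R =
  (∀ (x : X) → GaloisStableA I (R ↓[ ⟦ x ⟧ ]))
  × (∀ (a : A) → GaloisStableX I (R ↑[ ⟦ a ⟧ ]))

⋂ᴿ : {A X J : Set} → (J → REL A X 0ℓ) → REL A X 0ℓ
⋂ᴿ R a x = ∀ j → R j a x

⋂ˢ : {B J : Set} → (J → Pred B 0ℓ) → Pred B 0ℓ
⋂ˢ P b = ∀ j → P j b

module Submission where

-- The argument rests on three general facts about the Galois connection
-- B ↦ I↑[B], Y ↦ I↓[Y] of a formal context (A, X, I):
--   * the derivation S↓[-] turns an intersection of relations into the
--     intersection of the derived sets (this is already part (2));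
--   * Galois-stable sets are closed under arbitrary intersections, because
--     B ↦ B↑↓ is extensive and monotone;
--   * Galois-stability is invariant under extensional equality of sets.
-- Together they show that (⋂R)↓[x] = ⋂_T T↓[x] is stable.  The condition on
-- R↑[a] is the same condition for the transposed context (X, A, flip I):
-- I↑[-] is definitionally (flip I)↓[-], so GaloisStableX I is
-- GaloisStableA (flip I), and the X-side follows from the A-side by duality.

open import Defs
open import Data.Product using (_×_; _,_; proj₁; proj₂)
open import Function using (flip)
open import Relation.Unary using (Pred; _≐_; _⊆_)
open import Relation.Binary using (REL)
open import Level using (0ℓ)

module _ {A X : Set} where

  ↓-⋂ : {J : Set} (R : J → REL A X 0ℓ) (Y : Pred X 0ℓ) →
        (⋂ᴿ R) ↓[ Y ] ≐ ⋂ˢ (λ j → R j ↓[ Y ])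
  ↓-⋂ R Y = (λ a∈ j x x∈Y → a∈ x x∈Y j) , (λ a∈ x x∈Y j → a∈ j x x∈Y)

  module _ (I : REL A X 0ℓ) where

    closure-extensive : (B : Pred A 0ℓ) → B ⊆ I ↓[ I ↑[ B ] ]
    closure-extensive B a∈B x x∈B↑ = x∈B↑ _ a∈B

    -- The Galois closure is monotone (composite of two antitone maps).
    closure-monotone : {B C : Pred A 0ℓ} → B ⊆ C → I ↓[ I ↑[ B ] ] ⊆ I ↓[ I ↑[ C ] ]
    closure-monotone B⊆C a∈B↑↓ x x∈C↑ = a∈B↑↓ x (λ b b∈B → x∈C↑ b (B⊆C b∈B))

    -- Galois-stable sets are closed under arbitrary intersections: the
    -- closure of ⋂P lies in the closure of each P j, which is P j itself.
    stable-⋂ : {J : Set} (P : J → Pred A 0ℓ) →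
               (∀ j → GaloisStableA I (P j)) → GaloisStableA I (⋂ˢ P)
    stable-⋂ P stable =
      closure-extensive (⋂ˢ P) ,
      λ a∈closure j → proj₂ (stable j) (closure-monotone (λ a∈⋂P → a∈⋂P j) a∈closure)

    stable-resp-≐ : {B C : Pred A 0ℓ} → B ≐ C →
                    GaloisStableA I C → GaloisStableA I B
    stable-resp-≐ {B} (B⊆C , C⊆B) (_ , closedC) =
      closure-extensive B , λ a∈B↑↓ → C⊆B (closedC (closure-monotone B⊆C a∈B↑↓))

    compatibleA-⋂ : {J : Set} (R : J → REL A X 0ℓ) →
                    (∀ j x → GaloisStableA I (R j ↓[ ⟦ x ⟧ ])) →
                    ∀ x → GaloisStableA I (⋂ᴿ R ↓[ ⟦ x ⟧ ])
    compatibleA-⋂ R stable x =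
      stable-resp-≐ (↓-⋂ R ⟦ x ⟧) (stable-⋂ (λ j → R j ↓[ ⟦ x ⟧ ]) (λ j → stable j x))

lemmaA12 : (A X : Set) (I : REL A X 0ℓ) (J : Set) (R : J → REL A X 0ℓ) →
    (∀ j → Compatible I (R j)) →
    Compatible I (⋂ᴿ R)
    × (∀ (Y : Pred X 0ℓ) → (⋂ᴿ R) ↓[ Y ] ≐ ⋂ˢ (λ j → R j ↓[ Y ]))
lemmaA12 A X I J R compatible = (stableA , stableX) , ↓-⋂ R
  where
  stableA : ∀ x → GaloisStableA I (⋂ᴿ R ↓[ ⟦ x ⟧ ])
  stableA = compatibleA-⋂ I R (λ j → proj₁ (compatible j))

  -- The X-side is the A-side for the transposed context (X, A, flip I).
  stableX : ∀ a → GaloisStableX I (⋂ᴿ R ↑[ ⟦ a ⟧ ])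
  stableX = compatibleA-⋂ (flip I) (λ j → flip (R j)) (λ j → proj₂ (compatible j))
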